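{- Let $k$ be a natural number, $x$ large, and $y=x^{1/(4\log\log x)}$. Let $n\le x$ be of the form $n=pm$ where $p=P^+(n)$ is prime with $p>\max\{y,P^+(m)\}$ (so $p\nmid m$). Then the following are equivalent: (i) $n$ is $k$-near-perfect via a representation in which all positive divisors of $m$ are among the (at most $k$) omitted proper divisors of $n$; (ii) $\tau(m)\le k$ and $m$ is $(k-\tau(m))$-near-perfect. In particular, if (i) holds then $m$ is $\frac{k-1}{2}$-near-perfect.
   Context: $P^+(n)$ is the largest prime factor of $n$, $\tau(m)$ the number of positive divisors of $m$. For a real $t\ge0$, a natural number $m$ is $t$-near-perfect if $m$ equals the sum of all of its proper divisors except for at most $t$ of them (the omitted ones are called redundant divisors); $0$-near-perfect means perfect. In the paper, condition (i) defines membership of $n$ in the set $N_3^{(1)}(k;x)$. -}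

module Defs where

open import Data.Nat using (ℕ; suc; _+_; _*_; _∸_; _≤_)
open import Data.Nat.Divisibility using (_∣_; _∣?_)
open import Data.List using (List; filter; applyUpTo; length)
open import Data.Nat.ListAction using (sum)
open import Data.List.Membership.Propositional using (_∈_)
open import Data.List.Relation.Binary.Sublist.Propositional using (_⊆_)
open import Data.Product using (Σ; _×_)

divisors : ℕ → List ℕ
divisors m = filter (_∣? m) (applyUpTo suc m)

properDivisors : ℕ → List ℕ
properDivisors m = filter (_∣? m) (applyUpTo suc (m ∸ 1))

τ : ℕ → ℕ
τ m = length (divisors m)

-- S is a set of redundant divisors for m: S is a sub-collection
-- (a sublist, hence distinct elements) of the proper divisors of m,
-- and m equals the sum of the proper divisors not in S.
Redundant : ℕ → List ℕ → Set
Redundant m S = (S ⊆ properDivisors m) × (sum (properDivisors m) ≡ m + sum S)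
  where open import Relation.Binary.PropositionalEquality using (_≡_)

NearPerfect : ℕ → ℕ → Set
NearPerfect t m = Σ (List ℕ) λ S → Redundant m S × (length S ≤ t)

-- m is ((k-1)/2)-near-perfect, real threshold (k-1)/2:
-- the number r of redundant divisors satisfies r ≤ (k-1)/2, i.e. 2r + 1 ≤ k
NearPerfectHalfPred : ℕ → ℕ → Set
NearPerfectHalfPred k m = Σ (List ℕ) λ S → Redundant m S × (2 * length S + 1 ≤ k)

ConditionI : ℕ → ℕ → ℕ → Set
ConditionI k p m = Σ (List ℕ) λ S →
  Redundant (p * m) S × (length S ≤ k) × ((d : ℕ) → 1 ≤ d → d ∣ m → d ∈ S)

-- The proper divisors of n = p m (p prime, p ∤ m) are the divisors of m together with
-- p times the proper divisors of m.  Hence a redundant set S of n containing every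
-- divisor of m is the divisors of m together with p T for some T ⊆ properDivisors m,
-- and the defining identity σ(m) + p s(m) = p m + σ(m) + p ΣT (σ and s the sums of all
-- and of proper divisors) reduces to s(m) = m + ΣT.  So S ↔ T matches redundant sets of n of size
-- τ(m) + |T| with redundant sets of m of size |T|; finally |T| < τ(m) gives 2|T| + 1 ≤ k.
module Submission where

open import Defs
open import Data.Nat using (ℕ; zero; suc; _+_; _*_; _∸_; _≤_; _<_; z≤n; s≤s; NonZero; _≟_; >-nonZero; >-nonZero⁻¹; nonTrivial⇒n>1)
open import Data.Nat.Properties
open import Data.Nat.Divisibility
  using (_∣_; divides; _∣?_; ∣⇒≤; ∣-refl; ∣-trans; m∣m*n; n∣m*n; *-cancelˡ-∣; *-monoʳ-∣)
open import Data.Nat.Primality using (Prime; prime⇒nonZero; prime⇒nonTrivial; prime⇒irreducible)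
open import Data.Nat.Coprimality using (Coprime; coprime-divisor)
open import Data.Nat.ListAction using (sum)
open import Data.Nat.ListAction.Properties using (sum-++; sum-↭)
open import Data.Nat.Solver using (module +-*-Solver)
open import Data.List using (List; []; _∷_; [_]; _++_; map; filter; applyUpTo; length)
open import Data.List.Properties
  using (length-++; length-map; applyUpTo-∷ʳ; filter-++; filter-accept)
open import Data.List.Membership.Propositional using (_∈_)
open import Data.List.Membership.Propositional.Properties
  using (∈-map⁺; ∈-map⁻; ∈-++⁺ˡ; ∈-++⁺ʳ; ∈-++⁻; ∈-applyUpTo⁺; ∈-applyUpTo⁻; ∈-filter⁺; ∈-filter⁻)
open import Data.List.Membership.Propositional.Properties.WithK using (unique∧set⇒bag)
open import Data.List.Membership.DecPropositional _≟_ using (_∈?_)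
open import Data.List.Relation.Unary.AllPairs using ([]; _∷_)
open import Data.List.Relation.Unary.Unique.Propositional using (Unique)
import Data.List.Relation.Unary.Unique.Propositional.Properties as Unique
open import Data.List.Relation.Binary.Sublist.Propositional using (_⊆_; []; _∷ʳ_; _∷_; ⊆-refl)
open import Data.List.Relation.Binary.Sublist.Propositional.Properties
  using (All-resp-⊆; Any-resp-⊆; filter-⊆)
open import Data.List.Relation.Binary.Sublist.Heterogeneous.Properties using (length-mono-≤)
open import Data.List.Relation.Binary.Permutation.Propositional using (_↭_)
open import Data.List.Relation.Binary.Permutation.Propositional.Properties using (↭-length)
open import Data.List.Relation.Binary.BagAndSetEquality using (∼bag⇒↭)
open import Data.Product using (∃-syntax; _×_; _,_; proj₁; proj₂; uncurry)
open import Data.Sum using (_⊎_; inj₁; inj₂)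
open import Data.Empty using (⊥-elim)
open import Function using (_∘_; case_of_)
open import Function.Bundles using (_⇔_; mk⇔; Equivalence)
open import Relation.Nullary using (¬_; yes; no)
open import Relation.Unary using (Decidable)
open import Relation.Binary.PropositionalEquality using (_≡_; refl; sym; trans; cong; subst; subst₂; module ≡-Reasoning)

module _ {a} {A : Set a} where

  unique∧same-members⇒↭ : {xs ys : List A} → Unique xs → Unique ys →
    (∀ {x} → x ∈ xs → x ∈ ys) → (∀ {x} → x ∈ ys → x ∈ xs) → xs ↭ ys
  unique∧same-members⇒↭ u v f g = ∼bag⇒↭ (unique∧set⇒bag u v (mk⇔ f g))

  Unique-resp-⊇ : {xs ys : List A} → xs ⊆ ys → Unique ys → Unique xs
  Unique-resp-⊇ []           []         = []
  Unique-resp-⊇ (_ ∷ʳ xs⊆)   (_ ∷ u)    = Unique-resp-⊇ xs⊆ u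
  Unique-resp-⊇ (refl ∷ xs⊆) (x∉ ∷ u)   = All-resp-⊆ xs⊆ x∉ ∷ Unique-resp-⊇ xs⊆ u

filter-∈-↭ : {xs ys : List ℕ} → Unique xs → Unique ys →
  (∀ {y} → y ∈ ys → y ∈ xs) → filter (_∈? ys) xs ↭ ys
filter-∈-↭ {xs} {ys} u v ys⊆xs = unique∧same-members⇒↭ (Unique.filter⁺ (_∈? ys) u) v
  (proj₂ ∘ ∈-filter⁻ (_∈? ys) {xs = xs})
  (λ y∈ys → ∈-filter⁺ (_∈? ys) (ys⊆xs y∈ys) y∈ys)

sum-map-* : ∀ p xs → sum (map (p *_) xs) ≡ p * sum xs
sum-map-* p []       = sym (*-zeroʳ p)
sum-map-* p (x ∷ xs) = trans (cong (p * x +_) (sum-map-* p xs)) (sym (*-distribˡ-+ p x (sum xs)))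

σ+p*a≡p*m+[σ+p*b]⇔a≡m+b : ∀ σ p m a b .{{_ : NonZero p}} →
  (σ + p * a ≡ p * m + (σ + p * b)) ⇔ (a ≡ m + b)
σ+p*a≡p*m+[σ+p*b]⇔a≡m+b σ p m a b = mk⇔
  (λ eq → *-cancelˡ-≡ a (m + b) p (+-cancelˡ-≡ σ _ _ (trans eq (regroup p m σ b))))
  (λ eq → trans (cong (λ c → σ + p * c) eq) (sym (regroup p m σ b)))
  where
  open +-*-Solver
  regroup : ∀ p m σ b → p * m + (σ + p * b) ≡ σ + p * (m + b)
  regroup = solve 4 (λ p m σ b → p :* m :+ (σ :+ p :* b) := σ :+ p :* (m :+ b)) refl

¬∣⇒coprime : ∀ {p x} → Prime p → ¬ p ∣ x → Coprime x p
¬∣⇒coprime p-prime p∤x (d∣x , d∣p) with prime⇒irreducible p-prime d∣p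
... | inj₁ d≡1  = d≡1
... | inj₂ refl = ⊥-elim (p∤x d∣x)

applyUpTo-suc-unique : ∀ n → Unique (applyUpTo suc n)
applyUpTo-suc-unique n = Unique.applyUpTo⁺₁ suc n (λ i<j _ eq → <-irrefl (suc-injective eq) i<j)

∈-applyUpTo-suc⁻ : ∀ {x n} → x ∈ applyUpTo suc n → 1 ≤ x × x ≤ n
∈-applyUpTo-suc⁻ x∈ with ∈-applyUpTo⁻ suc x∈
... | _ , i<n , refl = s≤s z≤n , i<n

∈-applyUpTo-suc⁺ : ∀ {x n} → 1 ≤ x → x ≤ n → x ∈ applyUpTo suc n
∈-applyUpTo-suc⁺ {suc _} _ x≤n = ∈-applyUpTo⁺ suc x≤n

divisors-unique : ∀ n → Unique (divisors n)
divisors-unique n = Unique.filter⁺ (_∣? n) (applyUpTo-suc-unique n)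

properDivisors-unique : ∀ n → Unique (properDivisors n)
properDivisors-unique n = Unique.filter⁺ (_∣? n) (applyUpTo-suc-unique (n ∸ 1))

∈-divisors⁻ : ∀ {x n} → x ∈ divisors n → 1 ≤ x × x ∣ n
∈-divisors⁻ {n = n} x∈ with ∈-filter⁻ (_∣? n) {xs = applyUpTo suc n} x∈
... | x∈range , x∣n = proj₁ (∈-applyUpTo-suc⁻ x∈range) , x∣n

∈-divisors⁺ : ∀ {x n} .{{_ : NonZero n}} → 1 ≤ x → x ∣ n → x ∈ divisors n
∈-divisors⁺ {n = n} 1≤x x∣n = ∈-filter⁺ (_∣? n) (∈-applyUpTo-suc⁺ 1≤x (∣⇒≤ x∣n)) x∣n

∈-properDivisors⁻ : ∀ {x n} → x ∈ properDivisors n → 1 ≤ x × x < n × x ∣ n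
∈-properDivisors⁻ {n = zero} ()
∈-properDivisors⁻ {n = suc n} x∈ with ∈-filter⁻ (_∣? suc n) {xs = applyUpTo suc n} x∈
... | x∈range , x∣n with ∈-applyUpTo-suc⁻ x∈range
... | 1≤x , x≤n = 1≤x , s≤s x≤n , x∣n

∈-properDivisors⁺ : ∀ {x n} → 1 ≤ x → x < n → x ∣ n → x ∈ properDivisors n
∈-properDivisors⁺ {n = suc n} 1≤x (s≤s x≤n) x∣n = ∈-filter⁺ (_∣? suc n) (∈-applyUpTo-suc⁺ 1≤x x≤n) x∣n

divisors-suc : ∀ n → divisors (suc n) ≡ properDivisors (suc n) ++ [ suc n ]
divisors-suc n = begin
  filter P? (applyUpTo suc (suc n))             ≡⟨ cong (filter P?) (sym (applyUpTo-∷ʳ suc n)) ⟩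
  filter P? (applyUpTo suc n ++ [ suc n ])      ≡⟨ filter-++ P? (applyUpTo suc n) [ suc n ] ⟩
  properDivisors (suc n) ++ filter P? [ suc n ] ≡⟨ cong (properDivisors (suc n) ++_) (filter-accept P? ∣-refl) ⟩
  properDivisors (suc n) ++ [ suc n ]           ∎
  where
  open ≡-Reasoning
  P? : Decidable (_∣ suc n)
  P? = _∣? suc n

τ≡1+length-properDivisors : ∀ m .{{_ : NonZero m}} → τ m ≡ suc (length (properDivisors m))
τ≡1+length-properDivisors (suc n) = begin
  length (divisors (suc n))                     ≡⟨ cong length (divisors-suc n) ⟩
  length (properDivisors (suc n) ++ [ suc n ])  ≡⟨ length-++ (properDivisors (suc n)) ⟩
  length (properDivisors (suc n)) + 1           ≡⟨ +-comm _ 1 ⟩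
  suc (length (properDivisors (suc n)))         ∎
  where open ≡-Reasoning

length-⊆-properDivisors<τ : ∀ {m T} .{{_ : NonZero m}} → T ⊆ properDivisors m → length T < τ m
length-⊆-properDivisors<τ {m} T⊆ =
  subst (_ <_) (sym (τ≡1+length-properDivisors m)) (s≤s (length-mono-≤ T⊆))

module PrimeMultiple {p m : ℕ} (p-prime : Prime p) .{{_ : NonZero m}} (p∤m : ¬ p ∣ m) where

  private instance
    p≢0 : NonZero p
    p≢0 = prime⇒nonZero p-prime

  m<p*m : m < p * m
  m<p*m = subst (m <_) (*-comm m p) (m<m*n m p (nonTrivial⇒n>1 p {{prime⇒nonTrivial p-prime}}))

  ∣p*m⇒∣m⊎p*∣m : ∀ {x} → x ∣ p * m → x ∣ m ⊎ ∃[ d ] x ≡ p * d × d ∣ m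
  ∣p*m⇒∣m⊎p*∣m {x} x∣p*m with p ∣? x
  ... | no p∤x               = inj₁ (coprime-divisor (¬∣⇒coprime p-prime p∤x) x∣p*m)
  ... | yes (divides d refl) =
    inj₂ (d , *-comm d p , *-cancelˡ-∣ p (subst (_∣ p * m) (*-comm d p) x∣p*m))

  ∈-properDivisors-p*m⁻ : ∀ {x} → x ∈ properDivisors (p * m) →
    x ∈ divisors m ⊎ ∃[ d ] d ∈ properDivisors m × x ≡ p * d
  ∈-properDivisors-p*m⁻ x∈ with ∈-properDivisors⁻ x∈
  ... | 1≤x , x<p*m , x∣p*m with ∣p*m⇒∣m⊎p*∣m x∣p*m
  ... | inj₁ x∣m = inj₁ (∈-divisors⁺ 1≤x x∣m)
  ... | inj₂ (d , refl , d∣m) =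
    inj₂ (d , ∈-properDivisors⁺ 1≤d (*-cancelˡ-< p d m x<p*m) d∣m , refl)
    where
    1≤d : 1 ≤ d
    1≤d = >-nonZero⁻¹ d {{m*n≢0⇒n≢0 p {{>-nonZero 1≤x}}}}

  lift : List ℕ → List ℕ
  lift T = divisors m ++ map (p *_) T

  lift-unique : ∀ {T} → T ⊆ properDivisors m → Unique (lift T)
  lift-unique T⊆ = Unique.++⁺ (divisors-unique m)
    (Unique.map⁺ (λ {x} {y} → *-cancelˡ-≡ x y p) (Unique-resp-⊇ T⊆ (properDivisors-unique m)))
    λ (x∈divisors , x∈p*T) → case ∈-map⁻ (p *_) x∈p*T of λ where
      (d , _ , refl) → p∤m (∣-trans (m∣m*n d) (proj₂ (∈-divisors⁻ x∈divisors)))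

  ∈-lift⇒∈-properDivisors : ∀ {T x} → T ⊆ properDivisors m → x ∈ lift T → x ∈ properDivisors (p * m)
  ∈-lift⇒∈-properDivisors T⊆ x∈ with ∈-++⁻ (divisors m) x∈
  ... | inj₁ x∈divisors =
    let 1≤x , x∣m = ∈-divisors⁻ x∈divisors
    in ∈-properDivisors⁺ 1≤x (≤-<-trans (∣⇒≤ x∣m) m<p*m) (∣-trans x∣m (n∣m*n p))
  ... | inj₂ x∈p*T with ∈-map⁻ (p *_) x∈p*T
  ... | d , d∈T , refl =
    let 1≤d , d<m , d∣m = ∈-properDivisors⁻ (Any-resp-⊆ T⊆ d∈T)
    in ∈-properDivisors⁺ (≤-trans 1≤d (m≤n*m d p)) (*-monoʳ-< p d<m) (*-monoʳ-∣ p d∣m)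

  properDivisors-p*m↭lift : properDivisors (p * m) ↭ lift (properDivisors m)
  properDivisors-p*m↭lift = unique∧same-members⇒↭
    (properDivisors-unique (p * m)) (lift-unique ⊆-refl) into (∈-lift⇒∈-properDivisors ⊆-refl)
    where
    into : ∀ {x} → x ∈ properDivisors (p * m) → x ∈ lift (properDivisors m)
    into x∈ with ∈-properDivisors-p*m⁻ x∈
    ... | inj₁ x∈divisors       = ∈-++⁺ˡ x∈divisors
    ... | inj₂ (d , d∈ , refl) = ∈-++⁺ʳ (divisors m) (∈-map⁺ (p *_) d∈)

  sum-lift : ∀ T → sum (lift T) ≡ sum (divisors m) + p * sum T
  sum-lift T = trans (sum-++ (divisors m) _) (cong (sum (divisors m) +_) (sum-map-* p T))

  length-lift : ∀ T → length (lift T) ≡ τ m + length T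
  length-lift T = trans (length-++ (divisors m)) (cong (τ m +_) (length-map (p *_) T))

  redundancy-transfer : ∀ {S T} → S ↭ lift T →
    (sum (properDivisors (p * m)) ≡ p * m + sum S) ⇔ (sum (properDivisors m) ≡ m + sum T)
  redundancy-transfer {S} {T} S↭ =
    subst₂ (λ l r → (l ≡ p * m + r) ⇔ _) (sym sum-properDivisors-p*m) (sym sum-S)
      (σ+p*a≡p*m+[σ+p*b]⇔a≡m+b (sum (divisors m)) p m (sum (properDivisors m)) (sum T))
    where
    sum-properDivisors-p*m : sum (properDivisors (p * m)) ≡ sum (divisors m) + p * sum (properDivisors m)
    sum-properDivisors-p*m = trans (sum-↭ properDivisors-p*m↭lift) (sum-lift (properDivisors m))
    sum-S : sum S ≡ sum (divisors m) + p * sum T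
    sum-S = trans (sum-↭ S↭) (sum-lift T)

  length-redundant : ∀ {S T} → S ↭ lift T → length S ≡ length T + τ m
  length-redundant {T = T} S↭ = trans (↭-length S↭) (trans (length-lift T) (+-comm (τ m) _))

  ConditionI⇒redundant : ∀ {k} → ConditionI k p m →
    ∃[ T ] Redundant m T × length T + τ m ≤ k
  ConditionI⇒redundant {k} (S , (S⊆ , sum-S) , |S|≤k , divisors⊆S) =
    T , (filter-⊆ P? _ , Equivalence.to (redundancy-transfer S↭) sum-S) ,
    subst (_≤ k) (length-redundant S↭) |S|≤k
    where
    P? : Decidable (λ d → p * d ∈ S)
    P? d = p * d ∈? S
    T : List ℕ
    T = filter P? (properDivisors m)

    S⊆lift : ∀ {x} → x ∈ S → x ∈ lift T
    S⊆lift x∈S with ∈-properDivisors-p*m⁻ (Any-resp-⊆ S⊆ x∈S)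
    ... | inj₁ x∈divisors       = ∈-++⁺ˡ x∈divisors
    ... | inj₂ (d , d∈ , refl) = ∈-++⁺ʳ (divisors m) (∈-map⁺ (p *_) (∈-filter⁺ P? d∈ x∈S))

    lift⊆S : ∀ {x} → x ∈ lift T → x ∈ S
    lift⊆S x∈ with ∈-++⁻ (divisors m) x∈
    ... | inj₁ x∈divisors = let 1≤x , x∣m = ∈-divisors⁻ x∈divisors in divisors⊆S _ 1≤x x∣m
    ... | inj₂ x∈p*T with ∈-map⁻ (p *_) x∈p*T
    ... | d , d∈T , refl = proj₂ (∈-filter⁻ P? {xs = properDivisors m} d∈T)

    S↭ : S ↭ lift T
    S↭ = unique∧same-members⇒↭ (Unique-resp-⊇ S⊆ (properDivisors-unique (p * m)))
      (lift-unique (filter-⊆ P? _)) S⊆lift lift⊆S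

  redundant⇒ConditionI : ∀ {k T} → Redundant m T → length T + τ m ≤ k → ConditionI k p m
  redundant⇒ConditionI {k} {T} (T⊆ , sum-T) le =
    S , (filter-⊆ Q? _ , Equivalence.from (redundancy-transfer S↭) sum-T) ,
    subst (_≤ k) (sym (length-redundant S↭)) le , divisors⊆S
    where
    Q? : Decidable (_∈ lift T)
    Q? = _∈? lift T
    S : List ℕ
    S = filter Q? (properDivisors (p * m))

    S↭ : S ↭ lift T
    S↭ = filter-∈-↭ (properDivisors-unique (p * m)) (lift-unique T⊆) (∈-lift⇒∈-properDivisors T⊆)

    divisors⊆S : (d : ℕ) → 1 ≤ d → d ∣ m → d ∈ S
    divisors⊆S d 1≤d d∣m = ∈-filter⁺ Q? (∈-lift⇒∈-properDivisors T⊆ d∈) d∈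
      where
      d∈ : d ∈ lift T
      d∈ = ∈-++⁺ˡ (∈-divisors⁺ 1≤d d∣m)

NearPerfect⇒NearPerfectHalfPred : ∀ {k m} .{{_ : NonZero m}} →
  τ m ≤ k → NearPerfect (k ∸ τ m) m → NearPerfectHalfPred k m
NearPerfect⇒NearPerfectHalfPred {k} {m} τ≤k (T , redundant@(T⊆ , _) , t≤k∸τ) =
  T , redundant , 2t+1≤k
  where
  open ≤-Reasoning
  open +-*-Solver
  t : ℕ
  t = length T
  2t+1≡t+[1+t] : ∀ t → 2 * t + 1 ≡ t + suc t
  2t+1≡t+[1+t] = solve 1 (λ t → con 2 :* t :+ con 1 := t :+ (con 1 :+ t)) refl
  2t+1≤k : 2 * t + 1 ≤ k
  2t+1≤k = begin
    2 * t + 1     ≡⟨ 2t+1≡t+[1+t] t ⟩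
    t + suc t     ≤⟨ +-mono-≤ t≤k∸τ (length-⊆-properDivisors<τ T⊆) ⟩
    k ∸ τ m + τ m ≡⟨ m∸n+n≡m τ≤k ⟩
    k             ∎

lemma3p11 : (k p m : ℕ) → Prime p → 1 ≤ m →
    ((q : ℕ) → Prime q → q ∣ m → q < p) →
    (ConditionI k p m
      ⇔ ((τ m ≤ k) × NearPerfect (k ∸ τ m) m))
    × (ConditionI k p m
      → NearPerfectHalfPred k m)
lemma3p11 k p m p-prime 1≤m p-largest = mk⇔ to from , uncurry NearPerfect⇒NearPerfectHalfPred ∘ to
  where
  instance
    m≢0 : NonZero m
    m≢0 = >-nonZero 1≤m

  open PrimeMultiple p-prime (λ p∣m → <-irrefl refl (p-largest p p-prime p∣m))

  to : ConditionI k p m → (τ m ≤ k) × NearPerfect (k ∸ τ m) m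
  to c with T , redundant , t+τ≤k ← ConditionI⇒redundant c =
    m+n≤o⇒n≤o (length T) t+τ≤k , T , redundant , m+n≤o⇒m≤o∸n (length T) t+τ≤k

  from : (τ m ≤ k) × NearPerfect (k ∸ τ m) m → ConditionI k p m
  from (τ≤k , T , redundant , t≤k∸τ) = redundant⇒ConditionI redundant (m≤o∸n⇒m+n≤o (length T) τ≤k t≤k∸τ)
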